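{- Let $\Sigma$ be a finite signature containing two distinct atoms $p_1,p_2$. Then there is no formula $\gamma$ built from atoms of $\Sigma$ using only the connectives $\bot,\vee,\wedge$ such that $[\![\gamma]\!]=[\![p_1\to p_2]\!]$.
   Context: $\Sigma$ is a finite set of atoms. Formulas are given by $\alpha ::= \bot \mid p \mid \alpha_1\wedge\alpha_2 \mid \alpha_1\vee\alpha_2 \mid \alpha_1\rightarrow\alpha_2$ with $p\in\Sigma$. A partial interpretation is a map $v:\Sigma\to\{0,1,2\}$; $\mathcal I$ is the set of all of them and $\mathcal I_c$ the set of classical ones (no atom mapped to $1$). The order on $\mathcal I$: $u\le v$ iff for every atom $p$, $u(p)\le v(p)$ and ($u(p)=0$ implies $v(p)=0$). For $S\subseteq\mathcal I$: $\overline S=\mathcal I\setminus S$; $S_c=S\cap\mathcal I_c$; $S\downarrow=\{u\in\mathcal I:\exists v\in S,\ v\ge u\}$ (so $S_c\downarrow=(S_c)\downarrow$). The denotation: $[\![\bot]\!]=\emptyset$; $[\![p]\!]=\{v\in\mathcal I: v(p)=2\}$; $[\![\alpha\wedge\beta]\!]=[\![\alpha]\!]\cap[\![\beta]\!]$; $[\![\alpha\vee\beta]\!]=[\![\alpha]\!]\cup[\![\beta]\!]$; $[\![\alpha\to\beta]\!]=\big(\overline{[\![\alpha]\!]}\cup[\![\beta]\!]\big)\cap\big(\overline{[\![\alpha]\!]}\cup[\![\beta]\!]\big)_c\downarrow$. -}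

module Defs where

open import Data.Nat using (ℕ)
import Data.Nat as ℕ
open import Data.Fin using (Fin; zero; suc; toℕ)
open import Data.Product using (_×_; ∃; Σ)
open import Data.Sum using (_⊎_)
open import Data.Empty using (⊥)
open import Data.Unit using (⊤)
open import Relation.Nullary using (¬_)
open import Relation.Binary.PropositionalEquality using (_≡_; _≢_)

-- The signature Σ is Fin n (a finite set of n atoms).

data Formula (n : ℕ) : Set where
  `⊥  : Formula n
  atom : Fin n → Formula n
  _`∧_ : Formula n → Formula n → Formula n
  _`∨_ : Formula n → Formula n → Formula n
  _`→_ : Formula n → Formula n → Formula n

data ImplicationFree {n : ℕ} : Formula n → Set where
  if-⊥ : ImplicationFree `⊥
  if-atom : (p : Fin n) → ImplicationFree (atom p)
  if-∧ : {α β : Formula n} → ImplicationFree α → ImplicationFree β → ImplicationFree (α `∧ β)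
  if-∨ : {α β : Formula n} → ImplicationFree α → ImplicationFree β → ImplicationFree (α `∨ β)

-- Truth values {0,1,2} as Fin 3; partial interpretations.
Interp : ℕ → Set
Interp n = Fin n → Fin 3

one two : Fin 3
one = suc zero
two = suc (suc zero)

Classical : {n : ℕ} → Interp n → Set
Classical {n} v = (p : Fin n) → v p ≢ one

_≤ᴵ_ : {n : ℕ} → Interp n → Interp n → Set
_≤ᴵ_ {n} u v = (p : Fin n) → (toℕ (u p) ℕ.≤ toℕ (v p)) × (u p ≡ zero → v p ≡ zero)

ISet : ℕ → Set₁
ISet n = Interp n → Set

∅ : {n : ℕ} → ISet n
∅ _ = ⊥

_∩_ _∪_ : {n : ℕ} → ISet n → ISet n → ISet n
(S ∩ T) v = S v × T v
(S ∪ T) v = S v ⊎ T v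

complement : {n : ℕ} → ISet n → ISet n
complement S v = ¬ S v

classicalPart : {n : ℕ} → ISet n → ISet n
classicalPart S v = S v × Classical v

downClosure : {n : ℕ} → ISet n → ISet n
downClosure S u = ∃ λ v → S v × (u ≤ᴵ v)

⟦_⟧ : {n : ℕ} → Formula n → ISet n
⟦ `⊥ ⟧ = ∅
⟦ atom p ⟧ v = v p ≡ two
⟦ α `∧ β ⟧ = ⟦ α ⟧ ∩ ⟦ β ⟧
⟦ α `∨ β ⟧ = ⟦ α ⟧ ∪ ⟦ β ⟧
⟦ α `→ β ⟧ =
  (complement ⟦ α ⟧ ∪ ⟦ β ⟧) ∩ downClosure (classicalPart (complement ⟦ α ⟧ ∪ ⟦ β ⟧))

_≐_ : {n : ℕ} → ISet n → ISet n → Set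
_≐_ {n} S T = (v : Interp n) → (S v → T v) × (T v → S v)

-- The interpretation assigning 1 to every atom lies in [[p₁ → p₂]]: it falsifies p₁
-- and lies below the classical all-2 interpretation, which satisfies p₂. But a formula
-- built from ⊥, ∧, ∨ and atoms only holds where some atom takes the value 2.
module Submission where

open import Defs
open import Data.Nat using (ℕ; s≤s; z≤n)
open import Data.Fin using (Fin)
open import Data.Product using (_,_; proj₂)
open import Data.Sum using (inj₁; inj₂)
open import Relation.Nullary using (¬_)
open import Relation.Binary.PropositionalEquality using (_≢_; refl)

allOne allTwo : {n : ℕ} → Interp n
allOne _ = one
allTwo _ = two

allTwo-classical : {n : ℕ} → Classical (allTwo {n})
allTwo-classical _ ()

allOne≤allTwo : {n : ℕ} → allOne {n} ≤ᴵ allTwo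
allOne≤allTwo _ = s≤s z≤n , λ ()

implicationFree-false-without-two : {n : ℕ} {v : Interp n} {γ : Formula n} →
  (∀ p → v p ≢ two) → ImplicationFree γ → ¬ ⟦ γ ⟧ v
implicationFree-false-without-two no-two (if-atom p) vp≡2 = no-two p vp≡2
implicationFree-false-without-two no-two (if-∧ α _) (⟦α⟧ , _) =
  implicationFree-false-without-two no-two α ⟦α⟧
implicationFree-false-without-two no-two (if-∨ α _) (inj₁ ⟦α⟧) =
  implicationFree-false-without-two no-two α ⟦α⟧
implicationFree-false-without-two no-two (if-∨ _ β) (inj₂ ⟦β⟧) =
  implicationFree-false-without-two no-two β ⟦β⟧

implicationFree-false-at-allOne : {n : ℕ} {γ : Formula n} →
  ImplicationFree γ → ¬ ⟦ γ ⟧ allOne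
implicationFree-false-at-allOne = implicationFree-false-without-two (λ _ ())

→-holds-at-allOne : {n : ℕ} {α β : Formula n} →
  ¬ ⟦ α ⟧ allOne → ⟦ β ⟧ allTwo → ⟦ α `→ β ⟧ allOne
→-holds-at-allOne ¬⟦α⟧ ⟦β⟧ =
  inj₁ ¬⟦α⟧ , allTwo , (inj₂ ⟦β⟧ , allTwo-classical) , allOne≤allTwo

theorem4 : (n : ℕ) (p₁ p₂ : Fin n) → p₁ ≢ p₂ →
    (γ : Formula n) → ImplicationFree γ →
    ¬ (⟦ γ ⟧ ≐ ⟦ atom p₁ `→ atom p₂ ⟧)
theorem4 n p₁ p₂ _ γ γ-implicationFree γ≐p₁→p₂ =
  implicationFree-false-at-allOne γ-implicationFree
    (proj₂ (γ≐p₁→p₂ allOne) (→-holds-at-allOne {α = atom p₁} {β = atom p₂} (λ ()) refl))
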